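{- For every integer $n\ge 5$, there is an injection from $P_8(0,n)$ into $U_4(0,n)$.
   Context: Durfee symbol of a partition $\lambda$. Set $\lambda_k=0$ for $k>\ell(\lambda)$. Let $d=\max\{k:\lambda_k\ge k\}$, with $d=0$ for the empty partition. Then $$\alpha=(\lambda_1-d,\ldots,\lambda_d-d)',$$ the conjugate of the partition formed by the positive entries, and $$\beta=(\lambda_{d+1},\ldots,\lambda_{\ell(\lambda)}).$$ This is written $(\alpha,\beta)_d$. Parts beyond the length are taken to be $0$. $P(0,n)$ is the set of partitions of $n$ with rank $0$, equivalently $\ell(\alpha)=\ell(\beta)$. $P_8(0,n)$ is the subset of $P(0,n)$ where $\beta_1<d$ and $\alpha_1\le d-2$. $U(0,n)$ is the set of partitions of $n$ with Durfee symbol $(\gamma,\delta)_{d'}$ such that $\ell(\gamma)-\ell(\delta)\le 0$ and $\gamma_1\le d'-1$. $U_4(0,n)$ is the subset of $U(0,n)$ where $\ell(\gamma)-\ell(\delta)=-1$ and $\delta_1=d'$. -}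

module Defs where

open import Data.Nat using (ℕ; zero; suc; _+_; _∸_; _≤_; _<_; _≤?_; _⊔_; _≤ᵇ_)
open import Data.Nat.Properties using ()
open import Data.Bool using (if_then_else_)
open import Data.List using (List; []; _∷_; length; map; filter; foldr; upTo; drop)
open import Data.Nat.ListAction using (sum)
open import Data.List.Relation.Unary.All using (All)
open import Data.List.Relation.Unary.Linked using (Linked)
open import Data.Product using (Σ; _×_; proj₁)
open import Relation.Binary.PropositionalEquality using (_≡_)

IsPartition : ℕ → List ℕ → Set
IsPartition n l = (sum l ≡ n) × All (λ x → 0 < x) l × Linked (λ a b → b ≤ a) l

-- λ_k (1-indexed), 0 beyond the length (and for k = 0).
part : List ℕ → ℕ → ℕ
part []       _             = 0
part (x ∷ xs) zero          = 0
part (x ∷ xs) (suc zero)    = x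
part (x ∷ xs) (suc (suc k)) = part xs (suc k)

oneTo : ℕ → List ℕ
oneTo m = map suc (upTo m)

first : List ℕ → ℕ
first []      = 0
first (x ∷ _) = x

maximum : List ℕ → ℕ
maximum = foldr _⊔_ 0

-- d = max { k : λ_k ≥ k }, 0 if no such k (only k ≤ ℓ(λ) can qualify)
durfee : List ℕ → ℕ
durfee l = maximum (map (λ k → if k ≤ᵇ part l k then k else 0) (oneTo (length l)))

conj : List ℕ → List ℕ
conj μ = map (λ j → length (filter (λ x → j ≤? x) μ)) (oneTo (maximum μ))

-- Durfee symbol (α, β)_d
alpha : List ℕ → List ℕ
alpha l = conj (filter (λ x → 1 ≤? x) (map (λ i → part l i ∸ durfee l) (oneTo (durfee l))))

beta : List ℕ → List ℕ
beta l = drop (durfee l) l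

InP0 : ℕ → List ℕ → Set
InP0 n l = IsPartition n l × (length (alpha l) ≡ length (beta l))

-- P_8(0,n): additionally β_1 < d and α_1 ≤ d - 2 (integer subtraction: α_1 + 2 ≤ d)
InP8 : ℕ → List ℕ → Set
InP8 n l = InP0 n l × (first (beta l) < durfee l) × (first (alpha l) + 2 ≤ durfee l)

-- U(0,n): Durfee symbol (γ,δ)_{d'} with ℓ(γ) - ℓ(δ) ≤ 0 and γ_1 ≤ d' - 1 (i.e. γ_1 + 1 ≤ d')
InU : ℕ → List ℕ → Set
InU n l = IsPartition n l × (length (alpha l) ≤ length (beta l)) × (first (alpha l) + 1 ≤ durfee l)

-- U_4(0,n): additionally ℓ(γ) - ℓ(δ) = -1 and δ_1 = d'
InU4 : ℕ → List ℕ → Set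
InU4 n l = InU n l × (length (alpha l) + 1 ≡ length (beta l)) × (first (beta l) ≡ durfee l)

P8 : ℕ → Set
P8 n = Σ (List ℕ) (InP8 n)

U4 : ℕ → Set
U4 n = Σ (List ℕ) (InU4 n)

InjectiveOnPartitions : ∀ {n} → (P8 n → U4 n) → Set
InjectiveOnPartitions f = ∀ x y → proj₁ (f x) ≡ proj₁ (f y) → proj₁ x ≡ proj₁ y

module Submission where

-- Let d be the Durfee size of λ ∈ P₈(0,n). Since α₁ counts the rows of the Durfee square that
-- stick out of it, α₁ ≤ d − 2 forces λ_{d−1} = λ_d = d, and n ≥ 5 excludes λ = (2,2), so d ≥ 3.
-- Remove the last cell of rows d − 1 and d and add a new part 2. The Durfee square of the result
-- has side d − 1, its β is (d − 1) followed by β ∪ {2}, its α has length λ₁ − d + 1 = ℓ(β) + 1,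
-- one less than that of its β, and row d − 1 now ends on the square, so its α₁ ≤ d − 2: the
-- result lies in U₄(0,n). The map is injective because the side of the new Durfee square
-- recovers d, hence the rows above the square and β ∪ {2}, from which β is recovered since
-- both lists are sorted.

open import Defs
open import Data.Bool using (true; false; T; if_then_else_)
open import Data.Empty using (⊥-elim)
open import Data.List using (List; []; _∷_; _++_; head; length; map; filter; applyUpTo; take; drop)
open import Data.List.Properties
  using (∷-injective; ∷-injectiveʳ; length-applyUpTo; length-take; map-applyUpTo; take++drop≡id;
         filter-idem; filter-notAll)
open import Data.List.Membership.Propositional.Properties using (foldr-selective)
open import Data.List.Relation.Binary.Equality.Propositional using (≋⇒≡)
open import Data.List.Relation.Binary.Permutation.Propositional
  using (_↭_; ↭-reflexive; ↭-sym; ↭-trans; ↭⇒↭ₛ)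
open import Data.List.Relation.Binary.Permutation.Propositional.Properties
  using (All-resp-↭; drop-∷; ↭-length)
open import Data.List.Relation.Unary.All using (All; []; _∷_)
import Data.List.Relation.Unary.All.Properties as All
open import Data.List.Relation.Unary.Any using (Any; here; there)
import Data.List.Relation.Unary.Any.Properties as Any
open import Data.List.Relation.Unary.Linked using (Linked; []; [-]; _∷_; _∷′_) renaming (tail to linked-tail)
open import Data.Maybe using (just)
open import Data.Maybe.Relation.Binary.Connected using (Connected; just; just-nothing)
open import Data.Nat using (ℕ; zero; suc; _+_; _∸_; _≤_; _<_; _≤ᵇ_; _⊔_; z≤n; s≤s)
open import Data.Nat.ListAction using (sum)
open import Data.Nat.ListAction.Properties using (sum-++; sum-↭)
open import Data.Nat.Properties
open import Data.Product using (Σ; _×_; _,_; proj₁; proj₂; map₁)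
open import Data.Sum using (_⊎_; inj₁; inj₂)
open import Data.Unit using (tt)
open import Function using (_∘_)
open import Relation.Binary.Properties.DecTotalOrder ≤-decTotalOrder using (≥-decTotalOrder; ≥-totalOrder)
open import Relation.Binary.PropositionalEquality
open import Relation.Nullary using (¬_; does; contradiction)

open import Data.List.Relation.Unary.Sorted.TotalOrder ≥-totalOrder using (Sorted)
open import Data.List.Relation.Unary.Sorted.TotalOrder.Properties using (↗↭↗⇒≋)
open import Data.List.Sort.InsertionSort.Base ≥-decTotalOrder using (insert)
open import Data.List.Sort.InsertionSort.Properties ≥-decTotalOrder using (insert-↭; insert-↗)

++-cancel-≡length : ∀ {A : Set} (xs ys : List A) {zs ws} → length xs ≡ length ys →
                    xs ++ zs ≡ ys ++ ws → xs ≡ ys × zs ≡ ws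
++-cancel-≡length []       []       _  eq = refl , eq
++-cancel-≡length (x ∷ xs) (y ∷ ys) le eq with ∷-injective eq
... | refl , eq′ with ++-cancel-≡length xs ys (suc-injective le) eq′
...   | refl , eq″ = refl , eq″

linked-++⁻ʳ : ∀ {A : Set} {R : A → A → Set} xs {ys} → Linked R (xs ++ ys) → Linked R ys
linked-++⁻ʳ []       L = L
linked-++⁻ʳ (x ∷ xs) L = linked-++⁻ʳ xs (linked-tail L)

linked-++-replace : ∀ {A : Set} {R : A → A → Set} xs {y z ys zs} → (∀ {x} → R x y → R x z) →
                    Linked R (xs ++ y ∷ ys) → Linked R (z ∷ zs) → Linked R (xs ++ z ∷ zs)
linked-++-replace []            _   _       L′ = L′
linked-++-replace (x ∷ [])      R⇒R (r ∷ _) L′ = R⇒R r ∷ L′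
linked-++-replace (x ∷ x′ ∷ xs) R⇒R (r ∷ L) L′ = r ∷ linked-++-replace (x′ ∷ xs) R⇒R L L′

HeadAtMost : ℕ → List ℕ → Set
HeadAtMost c xs = Connected (λ a b → b ≤ a) (just c) (head xs)

first≤⇒headAtMost : ∀ {c} xs → first xs ≤ c → HeadAtMost c xs
first≤⇒headAtMost []      _   = just-nothing
first≤⇒headAtMost (x ∷ _) x≤c = just x≤c

insert-headAtMost : ∀ {c x} ys → x ≤ c → HeadAtMost c ys → HeadAtMost c (insert x ys)
insert-headAtMost         []       x≤c _          = just x≤c
insert-headAtMost {x = x} (y ∷ ys) x≤c (just y≤c) with does (y ≤? x)
... | true  = just x≤c
... | false = just y≤c

insert-injective : ∀ x {xs ys} → Sorted xs → Sorted ys → insert x xs ≡ insert x ys → xs ≡ ys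
insert-injective x {xs} {ys} xs↗ ys↗ eq = ≋⇒≡ (↗↭↗⇒≋ ≥-totalOrder xs↗ ys↗ (↭⇒↭ₛ xs↭ys))
  where
  xs↭ys : xs ↭ ys
  xs↭ys = drop-∷ (↭-trans (↭-sym (insert-↭ x xs)) (↭-trans (↭-reflexive eq) (insert-↭ x ys)))

drop-++ : ∀ {A : Set} (xs ys : List A) i → drop (i + length xs) (xs ++ ys) ≡ drop i ys
drop-++ []       ys i rewrite +-identityʳ i = refl
drop-++ (x ∷ xs) ys i rewrite +-suc i (length xs) = drop-++ xs ys i

part-++ : ∀ (xs ys : List ℕ) i → part (xs ++ ys) (suc (i + length xs)) ≡ part ys (suc i)
part-++ []       ys i rewrite +-identityʳ i = refl
part-++ (x ∷ xs) ys i rewrite +-suc i (length xs) = part-++ xs ys i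

part-pos⇒< : ∀ l i → 0 < part l (suc i) → i < length l
part-pos⇒< (x ∷ xs) zero    _   = s≤s z≤n
part-pos⇒< (x ∷ xs) (suc i) pos = s≤s (part-pos⇒< xs i pos)

part-antitone : ∀ {l} → Sorted l → ∀ {i j} → i ≤ j → part l (suc j) ≤ part l (suc i)
part-antitone []      _ = z≤n
part-antitone [-]     {j = zero}  z≤n = ≤-refl
part-antitone [-]     {j = suc j} _   = z≤n
part-antitone (r ∷ L) {j = zero}  z≤n = ≤-refl
part-antitone (r ∷ L) {j = suc j} z≤n = ≤-trans (part-antitone L {j = j} z≤n) r
part-antitone (r ∷ L) (s≤s i≤j) = part-antitone L i≤j

drop-part : ∀ (l : List ℕ) i → i < length l → drop i l ≡ part l (suc i) ∷ drop (suc i) l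
drop-part (x ∷ l) zero    _        = refl
drop-part (x ∷ l) (suc i) (s≤s i<) = drop-part l i i<

split-at-pair : ∀ l e {x} → part l (suc e) ≡ x → part l (suc (suc e)) ≡ x → 0 < x →
                l ≡ take e l ++ x ∷ x ∷ drop (suc (suc e)) l
split-at-pair l e refl λe+2≡x x>0 = begin
  l                                             ≡⟨ take++drop≡id e l ⟨
  take e l ++ drop e l                          ≡⟨ cong (take e l ++_) (drop-part l e (<-trans (n<1+n e) e+1<ℓ)) ⟩
  take e l ++ λe+1 ∷ drop (suc e) l             ≡⟨ cong (λ t → take e l ++ λe+1 ∷ t) (drop-part l (suc e) e+1<ℓ) ⟩
  take e l ++ λe+1 ∷ part l (suc (suc e)) ∷ B   ≡⟨ cong (λ y → take e l ++ λe+1 ∷ y ∷ B) λe+2≡x ⟩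
  take e l ++ λe+1 ∷ λe+1 ∷ B                   ∎
  where
  open ≡-Reasoning
  λe+1 : ℕ
  λe+1 = part l (suc e)
  B : List ℕ
  B = drop (suc (suc e)) l
  e+1<ℓ : suc e < length l
  e+1<ℓ = part-pos⇒< l (suc e) (subst (0 <_) (sym λe+2≡x) x>0)

maximum-≤ : ∀ {v xs} → All (_≤ v) xs → maximum xs ≤ v
maximum-≤ []       = z≤n
maximum-≤ (p ∷ ps) = ⊔-lub p (maximum-≤ ps)

≤-maximum : ∀ {v xs} → Any (v ≤_) xs → v ≤ maximum xs
≤-maximum (here p)  = ≤-trans p (m≤m⊔n _ _)
≤-maximum (there p) = ≤-trans (≤-maximum p) (m≤n⊔m _ _)

map-oneTo : ∀ (f : ℕ → ℕ) m → map f (oneTo m) ≡ applyUpTo (f ∘ suc) m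
map-oneTo f m = trans (cong (map f) (map-applyUpTo (λ x → x) suc m)) (map-applyUpTo suc f m)

length-map-oneTo : ∀ (f : ℕ → ℕ) m → length (map f (oneTo m)) ≡ m
length-map-oneTo f m = trans (cong length (map-oneTo f m)) (length-applyUpTo (f ∘ suc) m)

first-map-oneTo-≤ : ∀ (f : ℕ → ℕ) m → first (map f (oneTo m)) ≤ f 1
first-map-oneTo-≤ f zero    = z≤n
first-map-oneTo-≤ f (suc m) = ≤-refl

first-map-oneTo : ∀ (f : ℕ → ℕ) m → 0 < m → first (map f (oneTo m)) ≡ f 1
first-map-oneTo f (suc m) _ = refl

maximum-oneTo-≤ : ∀ f m {v} → (∀ {k} → k < m → f (suc k) ≤ v) → maximum (map f (oneTo m)) ≤ v
maximum-oneTo-≤ f m bound rewrite map-oneTo f m = maximum-≤ (All.applyUpTo⁺₁ (f ∘ suc) m bound)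

≤-maximum-oneTo : ∀ f m {k} → k < m → f (suc k) ≤ maximum (map f (oneTo m))
≤-maximum-oneTo f m k<m rewrite map-oneTo f m = ≤-maximum (Any.applyUpTo⁺ (f ∘ suc) ≤-refl k<m)

maximum-oneTo-sel : ∀ f m → maximum (map f (oneTo m)) ≡ 0
                    ⊎ Σ ℕ (λ k → k < m × maximum (map f (oneTo m)) ≡ f (suc k))
maximum-oneTo-sel f m rewrite map-oneTo f m with foldr-selective ⊔-sel 0 (applyUpTo (f ∘ suc) m)
... | inj₁ eq = inj₁ eq
... | inj₂ ∈xs with Any.applyUpTo⁻ (f ∘ suc) ∈xs
...   | k , k<m , eq = inj₂ (k , k<m , eq)

-- The Durfee square

-- durfee l is, by definition, the maximum of diagonal l k over k = 1, …, ℓ(λ).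
diagonal : List ℕ → ℕ → ℕ
diagonal l k = if k ≤ᵇ part l k then k else 0

diagonal-≡ : ∀ l k → k ≤ part l k → diagonal l k ≡ k
diagonal-≡ l k p = if-true (≤⇒≤ᵇ p)
  where
  if-true : ∀ {b} → T b → (if b then k else 0) ≡ k
  if-true {true} _ = refl

diagonal-≤ : ∀ l k {D} → (k ≤ part l k → k ≤ D) → diagonal l k ≤ D
diagonal-≤ l k {D} bound = if-≤ (k ≤ᵇ part l k) (bound ∘ ≤ᵇ⇒≤ k (part l k))
  where
  if-≤ : ∀ b → (T b → k ≤ D) → (if b then k else 0) ≤ D
  if-≤ true  f = f tt
  if-≤ false _ = z≤n

diagonal-pos : ∀ l k → 0 < diagonal l k → k ≤ part l k × diagonal l k ≡ k
diagonal-pos l k pos = map₁ (≤ᵇ⇒≤ k (part l k)) (if-pos (k ≤ᵇ part l k) pos)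
  where
  if-pos : ∀ b → 0 < (if b then k else 0) → T b × (if b then k else 0) ≡ k
  if-pos true  _ = tt , refl

≤-durfee : ∀ {l} D → D ≤ part l D → D ≤ durfee l
≤-durfee zero    _ = z≤n
≤-durfee {l} (suc D) D≤λD =
  ≤-trans (≤-reflexive (sym (diagonal-≡ l (suc D) D≤λD)))
          (≤-maximum-oneTo (diagonal l) (length l) (part-pos⇒< l D (≤-trans (s≤s z≤n) D≤λD)))

durfee-≤ : ∀ {l} D → Sorted l → part l (suc D) ≤ D → durfee l ≤ D
durfee-≤ {l} D l↗ λD+1≤D = maximum-oneTo-≤ (diagonal l) (length l) (λ {k} _ → diagonal-≤ l (suc k) (outside k))
  where
  outside : ∀ k → suc k ≤ part l (suc k) → suc k ≤ D
  outside k k<λk = ≮⇒≥ λ D<1+k → let D≤k = ≤-pred D<1+k in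
    n≮n k (≤-trans k<λk (≤-trans (part-antitone l↗ D≤k) (≤-trans λD+1≤D D≤k)))

durfee≤part : ∀ l → 0 < durfee l → durfee l ≤ part l (durfee l)
durfee≤part l pos with maximum-oneTo-sel (diagonal l) (length l)
... | inj₁ d≡0 = ⊥-elim (<-irrefl (sym d≡0) pos)
... | inj₂ (k , _ , d≡diag) with diagonal-pos l (suc k) (subst (0 <_) d≡diag pos)
...   | k≤λk , diag≡k rewrite trans d≡diag diag≡k = k≤λk

-- The α of the Durfee symbol

positives : List ℕ → List ℕ
positives = filter (λ x → 1 ≤? x)

overhang : List ℕ → ℕ → List ℕ
overhang l D = map (λ i → part l i ∸ D) (oneTo D)

-- alpha l is, by definition, alphaAt l (durfee l).
alphaAt : List ℕ → ℕ → List ℕ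
alphaAt l D = conj (positives (overhang l D))

length-conj : ∀ ν → length (conj ν) ≡ maximum ν
length-conj ν = length-map-oneTo _ (maximum ν)

first-conj-≤ : ∀ ν → first (conj ν) ≤ length (positives ν)
first-conj-≤ ν = first-map-oneTo-≤ _ (maximum ν)

first-conj : ∀ ν → 0 < maximum ν → first (conj ν) ≡ length (positives ν)
first-conj ν = first-map-oneTo _ (maximum ν)

maximum-positives : ∀ xs → maximum (positives xs) ≡ maximum xs
maximum-positives []           = refl
maximum-positives (zero  ∷ xs) = maximum-positives xs
maximum-positives (suc x ∷ xs) = cong (suc x ⊔_) (maximum-positives xs)

maximum-overhang : ∀ {l} D → Sorted l → 0 < D → maximum (overhang l D) ≡ part l 1 ∸ D
maximum-overhang {l} D l↗ D>0 = ≤-antisym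
  (maximum-oneTo-≤ _ D (λ _ → ∸-monoˡ-≤ D (part-antitone l↗ z≤n)))
  (≤-maximum-oneTo (λ i → part l i ∸ D) D D>0)

length-alpha : ∀ {l} → Sorted l → 0 < durfee l → length (alpha l) ≡ part l 1 ∸ durfee l
length-alpha {l} l↗ d>0 = begin
  length (alpha l)                             ≡⟨ length-conj (positives (overhang l (durfee l))) ⟩
  maximum (positives (overhang l (durfee l)))  ≡⟨ maximum-positives (overhang l (durfee l)) ⟩
  maximum (overhang l (durfee l))              ≡⟨ maximum-overhang (durfee l) l↗ d>0 ⟩
  part l 1 ∸ durfee l                          ∎
  where open ≡-Reasoning

≤-length-positives : ∀ f n k → (∀ {i} → i < k → 0 < f i) → k ≤ n →
                     k ≤ length (positives (applyUpTo f n))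
≤-length-positives f n       zero    _   _         = z≤n
≤-length-positives f (suc n) (suc k) pos (s≤s k≤n) with f 0 | pos (s≤s z≤n)
... | suc _ | _ = s≤s (≤-length-positives (f ∘ suc) n k (pos ∘ s≤s) k≤n)

first-alphaAt-< : ∀ l e → part l (suc e) ≤ suc e → first (alphaAt l (suc e)) < suc e
first-alphaAt-< l e λD≤D = begin-strict
  first (alphaAt l D)                ≤⟨ first-conj-≤ (positives oh) ⟩
  length (positives (positives oh))  ≡⟨ cong length (filter-idem (λ x → 1 ≤? x) oh) ⟩
  length (positives oh)              <⟨ filter-notAll (λ x → 1 ≤? x) oh last-row-flush ⟩
  length oh                          ≡⟨ length-map-oneTo _ D ⟩
  D                                  ∎
  where
  open ≤-Reasoning
  D : ℕ
  D = suc e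
  oh : List ℕ
  oh = overhang l D
  last-row-flush : Any (λ x → ¬ 1 ≤ x) oh
  last-row-flush rewrite map-oneTo (λ i → part l i ∸ D) D =
    Any.applyUpTo⁺ (λ k → part l (suc k) ∸ D) {i = e} (λ p → n≮n 0 (subst (1 ≤_) (m≤n⇒m∸n≡0 λD≤D) p)) ≤-refl

≤-first-alphaAt : ∀ {l D} i → Sorted l → i ≤ D → D < part l i → i ≤ first (alphaAt l D)
≤-first-alphaAt zero    _  _   _    = z≤n
≤-first-alphaAt {l} {D} (suc j) l↗ i≤D D<λi = begin
  suc j                               ≤⟨ ≤-length-positives f D (suc j) long-row i≤D ⟩
  length (positives (applyUpTo f D))  ≡⟨ cong (length ∘ positives) (map-oneTo (λ i → part l i ∸ D) D) ⟨
  length (positives oh)               ≡⟨ cong length (filter-idem (λ x → 1 ≤? x) oh) ⟨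
  length (positives (positives oh))   ≡⟨ first-conj (positives oh) max>0 ⟨
  first (alphaAt l D)                 ∎
  where
  open ≤-Reasoning
  f : ℕ → ℕ
  f = λ k → part l (suc k) ∸ D
  oh : List ℕ
  oh = overhang l D
  long-row : ∀ {k} → k < suc j → 0 < f k
  long-row (s≤s k≤j) = m<n⇒0<n∸m (≤-trans D<λi (part-antitone l↗ k≤j))
  max>0 : 0 < maximum (positives oh)
  max>0 = subst (0 <_) (sym (maximum-positives oh))
            (≤-trans (long-row (s≤s z≤n)) (≤-maximum-oneTo (λ i → part l i ∸ D) D (≤-trans (s≤s z≤n) i≤D)))

-- Partitions in P₈(0,n)

-- If λ_{d−1} > d, all of the rows 1, …, d − 1 stick out of the square, so α₁ ≥ d − 1.
corner-rows : ∀ {l} e → Sorted l → durfee l ≡ suc (suc e) → first (alpha l) + 2 ≤ durfee l →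
              part l (suc e) ≡ suc (suc e) × part l (suc (suc e)) ≡ suc (suc e)
corner-rows {l} e l↗ d≡ α₁+2≤d =
  ≤-antisym λe+1≤d (≤-trans d≤λd (part-antitone l↗ (n≤1+n e))) ,
  ≤-antisym (≤-trans (part-antitone l↗ (n≤1+n e)) λe+1≤d) d≤λd
  where
  D : ℕ
  D = suc (suc e)
  d≤λd : D ≤ part l D
  d≤λd = subst (λ d → d ≤ part l d) d≡ (durfee≤part l (subst (0 <_) (sym d≡) (s≤s z≤n)))
  α₁≤e : first (alphaAt l D) ≤ e
  α₁≤e = ≤-pred (≤-pred (≤-trans (≤-reflexive (+-comm 2 _)) (subst (λ d → first (alphaAt l d) + 2 ≤ d) d≡ α₁+2≤d)))
  λe+1≤d : part l (suc e) ≤ D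
  λe+1≤d = ≮⇒≥ λ d<λe+1 → n≮n e (≤-trans (≤-first-alphaAt (suc e) l↗ (n≤1+n (suc e)) d<λe+1) α₁≤e)

-- With d = ℓ(A) + 2, rows d − 1 and d end exactly on the corner of the d × d square.
framed : List ℕ → List ℕ → List ℕ
framed A B = A ++ suc (suc (length A)) ∷ suc (suc (length A)) ∷ B

record P8Frame (l : List ℕ) : Set where
  field
    A B      : List ℕ
    l≡framed : l ≡ framed A B
    A≢[]     : 0 < length A
    β₁<d     : first B < suc (suc (length A))
    λ₁≡d+ℓβ  : part (framed A B) 1 ≡ suc (suc (length A)) + length B

module P8Corner {l} (l↗ : Sorted l) (ℓα≡ℓβ : length (alpha l) ≡ length (beta l))
                (β₁<d : first (beta l) < durfee l) (α₁+2≤d : first (alpha l) + 2 ≤ durfee l)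
                (e : ℕ) (d≡ : durfee l ≡ suc (suc e)) where
  D : ℕ
  D = suc (suc e)
  B : List ℕ
  B = drop D l

  rows : part l (suc e) ≡ D × part l D ≡ D
  rows = corner-rows e l↗ d≡ α₁+2≤d

  split : l ≡ take e l ++ D ∷ D ∷ B
  split = split-at-pair l e (proj₁ rows) (proj₂ rows) (s≤s z≤n)

  length-take-e : length (take e l) ≡ e
  length-take-e = trans (length-take e l)
    (m≤n⇒m⊓n≡m (<⇒≤ (<-trans (n<1+n e) (part-pos⇒< l (suc e) (subst (0 <_) (sym (proj₂ rows)) (s≤s z≤n))))))

  β₁<D : first B < D
  β₁<D = subst (λ d → first (drop d l) < d) d≡ β₁<d

  λ₁≡D+ℓβ : part l 1 ≡ D + length B
  λ₁≡D+ℓβ = begin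
    part l 1            ≡⟨ m+[n∸m]≡n D≤λ₁ ⟨
    D + (part l 1 ∸ D)  ≡⟨ cong (D +_) (subst (λ d → part l 1 ∸ d ≡ length (drop d l)) d≡ rank) ⟩
    D + length B        ∎
    where
    open ≡-Reasoning
    D≤λ₁ : D ≤ part l 1
    D≤λ₁ = ≤-trans (≤-reflexive (sym (proj₁ rows))) (part-antitone l↗ z≤n)
    rank : part l 1 ∸ durfee l ≡ length (beta l)
    rank = trans (sym (length-alpha l↗ (subst (0 <_) (sym d≡) (s≤s z≤n)))) ℓα≡ℓβ

mkP8Frame : ∀ {l} A B e → length A ≡ e → l ≡ A ++ suc (suc e) ∷ suc (suc e) ∷ B → 0 < e →
            first B < suc (suc e) → part l 1 ≡ suc (suc e) + length B → P8Frame l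
mkP8Frame A B .(length A) refl split e>0 β₁< λ₁≡ = record
  { A = A ; B = B ; l≡framed = split ; A≢[] = e>0 ; β₁<d = β₁<
  ; λ₁≡d+ℓβ = subst (λ l → part l 1 ≡ _) split λ₁≡ }

p8-frame : ∀ {n l} → 5 ≤ n → InP8 n l → P8Frame l
p8-frame {n} {l} n≥5 (((Σl≡n , _ , l↗) , ℓα≡ℓβ) , β₁<d , α₁+2≤d) = framing (durfee l ∸ 2) d≡2+[d∸2]
  where
  module Corner = P8Corner l↗ ℓα≡ℓβ β₁<d α₁+2≤d

  d≡2+[d∸2] : durfee l ≡ suc (suc (durfee l ∸ 2))
  d≡2+[d∸2] = trans (sym (m∸n+n≡m (≤-trans (m≤n+m 2 _) α₁+2≤d))) (+-comm _ 2)

  -- For d = 2 the rank condition leaves only λ = (2,2), of size 4.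
  framing : ∀ e → durfee l ≡ suc (suc e) → P8Frame l
  framing zero d≡ with drop 2 l | Corner.split zero d≡ | Corner.λ₁≡D+ℓβ zero d≡ | Corner.rows zero d≡
  ... | []    | l≡2∷2 | _   | _        = contradiction (subst (5 ≤_) (trans (sym Σl≡n) (cong sum l≡2∷2)) n≥5) (<⇒≱ (n<1+n 4))
  ... | _ ∷ _ | _     | λ₁≡ | λ₁≡2 , _ = contradiction (trans (sym λ₁≡2) λ₁≡) λ ()
  framing (suc k) d≡ = mkP8Frame (take (suc k) l) B (suc k) length-take-e split (s≤s z≤n) β₁<D λ₁≡D+ℓβ
    where open Corner (suc k) d≡

sorted-framed⇒sorted-tail : ∀ A B → Sorted (framed A B) → Sorted B
sorted-framed⇒sorted-tail A B framed↗ = linked-tail (linked-tail (linked-++⁻ʳ A framed↗))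

-- The map

shiftCorner : List ℕ → List ℕ → List ℕ
shiftCorner A B = A ++ suc (length A) ∷ suc (length A) ∷ insert 2 B

shiftCorner-sorted : ∀ A B → 0 < length A → first B ≤ suc (length A) →
                     Sorted (framed A B) → Sorted (shiftCorner A B)
shiftCorner-sorted A B ℓA>0 β₁≤c framed↗ =
  linked-++-replace A (≤-trans (n≤1+n _)) framed↗
    (≤-refl ∷ (insert-headAtMost B (s≤s ℓA>0) (first≤⇒headAtMost B β₁≤c) ∷′ insert-↗ 2 B↗))
  where
  B↗ : Sorted B
  B↗ = sorted-framed⇒sorted-tail A B framed↗

shiftCorner-sum : ∀ A B → sum (shiftCorner A B) ≡ sum (framed A B)
shiftCorner-sum A B = begin
  sum (A ++ c ∷ c ∷ insert 2 B)         ≡⟨ sum-++ A _ ⟩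
  sum A + (c + (c + sum (insert 2 B)))  ≡⟨ cong (λ s → sum A + (c + (c + s))) (sum-↭ (insert-↭ 2 B)) ⟩
  sum A + (c + (c + (2 + sum B)))       ≡⟨ cong (sum A +_) (two-cells (sum B)) ⟩
  sum A + (suc c + (suc c + sum B))     ≡⟨ sum-++ A _ ⟨
  sum (framed A B)                      ∎
  where
  open ≡-Reasoning
  c : ℕ
  c = suc (length A)
  two-cells : ∀ s → c + (c + (2 + s)) ≡ suc c + (suc c + s)
  two-cells s = begin
    c + (c + suc (suc s))    ≡⟨ cong (c +_) (+-suc c (suc s)) ⟩
    c + suc (c + suc s)      ≡⟨ +-suc c _ ⟩
    suc (c + (c + suc s))    ≡⟨ cong (λ t → suc (c + t)) (+-suc c s) ⟩
    suc (c + suc (c + s))    ∎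

shiftCorner-positive : ∀ A B → All (0 <_) (framed A B) → All (0 <_) (shiftCorner A B)
shiftCorner-positive A B pos with All.++⁻ A pos
... | posA , _ ∷ _ ∷ posB =
  All.++⁺ posA (s≤s z≤n ∷ s≤s z≤n ∷ All-resp-↭ (↭-sym (insert-↭ 2 B)) (s≤s z≤n ∷ posB))

durfee-shiftCorner : ∀ A B → Sorted (shiftCorner A B) → durfee (shiftCorner A B) ≡ suc (length A)
durfee-shiftCorner A B μ↗ = ≤-antisym
  (durfee-≤ (suc (length A)) μ↗ (≤-reflexive (part-++ A _ 1)))
  (≤-durfee {shiftCorner A B} (suc (length A)) (≤-reflexive (sym (part-++ A _ 0))))

shiftCorner-∈U4 : ∀ {n} A B → 0 < length A → IsPartition n (framed A B) →
                  first B < suc (suc (length A)) → part (framed A B) 1 ≡ suc (suc (length A)) + length B →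
                  InU4 n (shiftCorner A B)
shiftCorner-∈U4 {n} (a ∷ A) B ℓA>0 (Σ≡n , pos , framed↗) β₁<d a≡d+ℓβ =
  ((partition , ℓα≤ℓβ , α₁+1≤d) , ℓα+1≡ℓβ , β₁≡d)
  where
  c : ℕ
  c = suc (length (a ∷ A))
  μ : List ℕ
  μ = shiftCorner (a ∷ A) B
  μ↗ : Sorted μ
  μ↗ = shiftCorner-sorted (a ∷ A) B ℓA>0 (≤-pred β₁<d) framed↗
  partition : IsPartition n μ
  partition = trans (shiftCorner-sum (a ∷ A) B) Σ≡n , shiftCorner-positive (a ∷ A) B pos , μ↗
  d≡c : durfee μ ≡ c
  d≡c = durfee-shiftCorner (a ∷ A) B μ↗
  ℓα≡ : length (alpha μ) ≡ suc (length B)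
  ℓα≡ = begin
    length (alpha μ)        ≡⟨ length-alpha μ↗ (subst (0 <_) (sym d≡c) (s≤s z≤n)) ⟩
    a ∸ durfee μ            ≡⟨ cong₂ _∸_ a≡d+ℓβ d≡c ⟩
    suc c + length B ∸ c    ≡⟨ cong (_∸ c) (+-suc c (length B)) ⟨
    c + suc (length B) ∸ c  ≡⟨ m+n∸m≡n c (suc (length B)) ⟩
    suc (length B)          ∎
    where open ≡-Reasoning
  β≡ : beta μ ≡ c ∷ insert 2 B
  β≡ = trans (cong (λ d → drop d μ) d≡c) (drop-++ (a ∷ A) (c ∷ c ∷ insert 2 B) 1)
  ℓβ≡ : length (beta μ) ≡ suc (suc (length B))
  ℓβ≡ = trans (cong length β≡) (cong suc (↭-length (insert-↭ 2 B)))
  ℓα≤ℓβ : length (alpha μ) ≤ length (beta μ)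
  ℓα≤ℓβ = subst₂ _≤_ (sym ℓα≡) (sym ℓβ≡) (n≤1+n _)
  α₁+1≤d : first (alpha μ) + 1 ≤ durfee μ
  α₁+1≤d = subst₂ _≤_ (+-comm 1 _) refl
    (subst (λ d → first (alphaAt μ d) < d) (sym d≡c) (first-alphaAt-< μ (length (a ∷ A)) (≤-reflexive (part-++ (a ∷ A) _ 0))))
  ℓα+1≡ℓβ : length (alpha μ) + 1 ≡ length (beta μ)
  ℓα+1≡ℓβ = trans (cong (_+ 1) ℓα≡) (trans (+-comm _ 1) (sym ℓβ≡))
  β₁≡d : first (beta μ) ≡ durfee μ
  β₁≡d = trans (cong first β≡) (sym d≡c)

module Image {l} (F : P8Frame l) where
  open P8Frame F public

  image : List ℕ
  image = shiftCorner A B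

  image-∈U4 : ∀ {n} → IsPartition n l → InU4 n image
  image-∈U4 l∈P = shiftCorner-∈U4 A B A≢[] (subst (IsPartition _) l≡framed l∈P) β₁<d λ₁≡d+ℓβ

  module _ (l↗ : Sorted l) where
    framed↗ : Sorted (framed A B)
    framed↗ = subst Sorted l≡framed l↗

    B↗ : Sorted B
    B↗ = sorted-framed⇒sorted-tail A B framed↗

    durfee-image : durfee image ≡ suc (length A)
    durfee-image = durfee-shiftCorner A B (shiftCorner-sorted A B A≢[] (≤-pred β₁<d) framed↗)

image-injective : ∀ {l l′} (F : P8Frame l) (F′ : P8Frame l′) → Sorted l → Sorted l′ →
                  Image.image F ≡ Image.image F′ → l ≡ l′
image-injective {l} {l′} F F′ l↗ l′↗ eq = begin
  l                 ≡⟨ I.l≡framed ⟩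
  framed I.A I.B    ≡⟨ cong₂ framed (proj₁ pieces) B≡B′ ⟩
  framed I′.A I′.B  ≡⟨ I′.l≡framed ⟨
  l′                ∎
  where
  open ≡-Reasoning
  module I  = Image F
  module I′ = Image F′
  ℓA≡ℓA′ : length I.A ≡ length I′.A
  ℓA≡ℓA′ = suc-injective (trans (sym (I.durfee-image l↗)) (trans (cong durfee eq) (I′.durfee-image l′↗)))
  pieces : I.A ≡ I′.A × suc (length I.A) ∷ suc (length I.A) ∷ insert 2 I.B
                      ≡ suc (length I′.A) ∷ suc (length I′.A) ∷ insert 2 I′.B
  pieces = ++-cancel-≡length I.A I′.A ℓA≡ℓA′ eq
  B≡B′ : I.B ≡ I′.B
  B≡B′ = insert-injective 2 (I.B↗ l↗) (I′.B↗ l′↗) (∷-injectiveʳ (∷-injectiveʳ (proj₂ pieces)))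

lemma4p8 : (n : ℕ) → 5 ≤ n → Σ (P8 n → U4 n) InjectiveOnPartitions
lemma4p8 n n≥5 = image , injective
  where
  frame : (x : P8 n) → P8Frame (proj₁ x)
  frame (_ , l∈P8) = p8-frame n≥5 l∈P8
  image : P8 n → U4 n
  image x@(_ , ((l∈P , _) , _)) = Image.image (frame x) , Image.image-∈U4 (frame x) l∈P
  injective : InjectiveOnPartitions image
  injective x@(_ , (((_ , _ , l↗) , _) , _)) y@(_ , (((_ , _ , l′↗) , _) , _)) =
    image-injective (frame x) (frame y) l↗ l′↗
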